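{- Let $m\ge 3$, let $n$ be an even positive integer, let $1\le i\le \frac{n}{2}-1$ and $j=i+\frac{n}{2}$, and let $f$ be a radio labeling of the stacked-book graph $G_{m,n}=S_m\Box P_n$. Let $G^+(i)$ be the vertex set $V_{(i)}\cup V_{(j)}\cup\{w_1\}$, where $w_1=u_1v_{j+1}$ is the center vertex of the $(j+1)$-th star copy. Then $$\max_{x\in G^+(i)} f(x)-\min_{x\in G^+(i)} f(x)\geq mn+3.$$
   Context: $S_m$ is the star with center $u_1$ and leaves $u_2,\dots,u_m$; $P_n$ is the path $v_1v_2\cdots v_n$. The stacked-book graph $G_{m,n}=S_m\Box P_n$ is the Cartesian product, with vertices $u_kv_j$, where $u_kv_j$ and $u_lv_{j'}$ are adjacent iff either $k=l$ and $|j-j'|=1$, or $j=j'$ and $u_ku_l$ is an edge of $S_m$. For $1\le j\le n$, $V_{(j)}=\{u_1v_j,\dots,u_mv_j\}$ is the vertex set of the $j$-th copy of the star, whose center is $u_1v_j$. $d$ denotes graph distance; $\mathrm{diam}(G_{m,n})=n+1$. A radio labeling of a connected graph $G$ is a function $f:V(G)\to\mathbb{Z}_{\ge0}$ with $|f(u)-f(v)|\ge \mathrm{diam}(G)+1-d(u,v)$ for all distinct $u,v$. -}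

module Defs where

open import Data.Nat using (ℕ; zero; suc; _+_; _*_; _≤_; ∣_-_∣)
open import Data.Fin using (Fin; toℕ)
open import Data.Product using (_×_; _,_; ∃)
open import Data.Sum using (_⊎_)
open import Relation.Binary.PropositionalEquality using (_≡_; _≢_)

-- Vertices of the stacked-book graph G_{m,n} = S_m □ P_n.
-- A vertex (k , p) stands for u_{k+1} v_{p+1} (0-based indices);
-- the star centre u_1 is the index k with toℕ k ≡ 0.
Vertex : ℕ → ℕ → Set
Vertex m n = Fin m × Fin n

StarAdj : {m : ℕ} → Fin m → Fin m → Set
StarAdj k l = (toℕ k ≡ 0 × toℕ l ≢ 0) ⊎ (toℕ l ≡ 0 × toℕ k ≢ 0)

PathAdj : {n : ℕ} → Fin n → Fin n → Set
PathAdj p q = (toℕ p ≡ suc (toℕ q)) ⊎ (toℕ q ≡ suc (toℕ p))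

Adj : {m n : ℕ} → Vertex m n → Vertex m n → Set
Adj (k , p) (l , q) = (k ≡ l × PathAdj p q) ⊎ (p ≡ q × StarAdj k l)

data Walk {m n : ℕ} : Vertex m n → Vertex m n → ℕ → Set where
  here : ∀ {x} → Walk x x 0
  step : ∀ {x y z ℓ} → Adj x y → Walk y z ℓ → Walk x z (suc ℓ)

IsDist : {m n : ℕ} → Vertex m n → Vertex m n → ℕ → Set
IsDist x y ℓ = Walk x y ℓ × (∀ ℓ' → Walk x y ℓ' → ℓ ≤ ℓ')

diamG : ℕ → ℕ → ℕ
diamG m n = n + 1

-- Radio labeling: |f(u) - f(v)| ≥ diam + 1 - d(u,v) for all distinct u, v
-- (written additively: |f u - f v| + d(u,v) ≥ diam + 1).
IsRadioLabeling : (m n : ℕ) → (Vertex m n → ℕ) → Set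
IsRadioLabeling m n f =
  ∀ (x y : Vertex m n) → x ≢ y → ∀ ℓ → IsDist x y ℓ →
    diamG m n + 1 ≤ ∣ f x - f y ∣ + ℓ

-- G^+(i) = V_(i) ∪ V_(j) ∪ {u_1 v_{j+1}}, with paper indices i, j (1-based).
InGPlus : {m n : ℕ} → (i j : ℕ) → Vertex m n → Set
InGPlus i j (k , p) =
  (suc (toℕ p) ≡ i) ⊎ (suc (toℕ p) ≡ j) ⊎ (toℕ k ≡ 0 × suc (toℕ p) ≡ suc j)

module Submission where

-- Order the 2m + 1 vertices of G⁺(i) by their labels.  For consecutive
-- vertices x, y the radio condition gives f y − f x ≥ n + 2 − d(x, y), and on
-- G⁺(i) the distance is bounded by d(x, y) ≤ h − 1 + λ x + λ y, where h = n/2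
-- and λ(u_k v_p) = [u_k is a leaf] + [p ≠ j].  Telescoping over the 2m gaps,
-- f max − f min ≥ 2m(h + 3) − 2 Σ λ + λ(first) + λ(last) = mn + 2 + λ(first) + λ(last),
-- and λ(first) + λ(last) ≥ 1 because only the centre of V_(j) has weight 0.
-- The argument needs only m ≥ 1.

open import Defs
open import Data.Empty using (⊥-elim)
open import Data.Fin using (Fin; toℕ; fromℕ<) renaming (zero to fzero; suc to fsuc)
open import Data.Fin.Properties using (toℕ-fromℕ<; toℕ-injective; toℕ<n)
  renaming (_≟_ to _≟ᶠ_; <⇒≢ to <⇒≢ᶠ)
open import Data.List using (List; []; _∷_; _++_; tabulate; map; length)
open import Data.List.Properties using (map-tabulate; map-++; length-++; length-tabulate)
open import Data.List.Membership.Propositional using (_∈_)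
open import Data.List.Relation.Binary.Permutation.Propositional using (↭-sym; ↭⇒↭ₛ)
import Data.List.Relation.Binary.Permutation.Propositional.Properties as ↭
import Data.List.Relation.Binary.Permutation.Setoid.Properties as Setoid↭
open import Data.List.Relation.Unary.All as All using (All; []; _∷_)
import Data.List.Relation.Unary.All.Properties as All
open import Data.List.Relation.Unary.AllPairs using (AllPairs; []; _∷_)
import Data.List.Relation.Unary.AllPairs.Properties as AllPairs
open import Data.List.Relation.Unary.Any using (here; there)
open import Data.List.Relation.Unary.Linked as Linked using (Linked; [-]; _∷_)
open import Data.List.Relation.Unary.Linked.Properties using (AllPairs⇒Linked)
import Data.List.Sort as Sort
open import Data.Nat using (ℕ; zero; suc; _+_; _*_; _≤_; _<_; _∸_; _⊓_; ∣_-_∣; z≤n; s≤s; z<s)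
open import Data.Nat.ListAction using (sum)
open import Data.Nat.ListAction.Properties using (sum-++; sum-↭)
open import Data.Nat.Properties
open import Algebra.Properties.CommutativeSemigroup +-commutativeSemigroup using (x∙yz≈y∙xz)
open import Data.Nat.Tactic.RingSolver using (solve-∀)
open import Data.Product using (_×_; _,_; ∃; ∃₂; proj₁; proj₂)
open import Data.Sum using (_⊎_; inj₁; inj₂)
open import Relation.Binary.PropositionalEquality
  using (_≡_; _≢_; refl; sym; trans; cong; cong₂; subst; subst₂; setoid; ≢-sym; module ≡-Reasoning)
import Relation.Binary.Construct.On as On
open import Relation.Nullary using (yes; no)

∣n-1+n∣≡1 : ∀ n → ∣ n - suc n ∣ ≡ 1
∣n-1+n∣≡1 zero    = refl
∣n-1+n∣≡1 (suc n) = ∣n-1+n∣≡1 n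

[_≢_] : ℕ → ℕ → ℕ
[ p ≢ b ] = 1 ⊓ ∣ p - b ∣

[≢]≡0⇒≡ : ∀ {p b} → [ p ≢ b ] ≡ 0 → p ≡ b
[≢]≡0⇒≡ {p} {b} e with ∣ p - b ∣ in d
... | zero = ∣m-n∣≡0⇒m≡n d

+-cancel-excess : ∀ {s t x y c w} → x + 1 ≡ c + y → 1 ≤ w → s + x + w ≤ t + y → s + c ≤ t
+-cancel-excess {s} {t} {x} {y} {c} {w} x+1≡c+y 1≤w ineq = +-cancelʳ-≤ y _ _ (begin
  s + c + y    ≡⟨ +-assoc s c y ⟩
  s + (c + y)  ≡⟨ cong (s +_) (sym x+1≡c+y) ⟩
  s + (x + 1)  ≡⟨ sym (+-assoc s x 1) ⟩
  s + x + 1    ≤⟨ +-monoʳ-≤ (s + x) 1≤w ⟩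
  s + x + w    ≤⟨ ineq ⟩
  t + y        ∎)
  where open ≤-Reasoning

sum-tabulate-const : ∀ k c → sum (tabulate {n = k} (λ _ → c)) ≡ k * c
sum-tabulate-const zero    c = refl
sum-tabulate-const (suc k) c = cong (c +_) (sum-tabulate-const k c)

allPairs-within : {A : Set} {P : A → Set} {R S : A → A → Set} →
  (∀ {x y} → P x → P y → R x y → S x y) → ∀ {xs} → All P xs → AllPairs R xs → AllPairs S xs
allPairs-within R⇒S []         []         = []
allPairs-within R⇒S (px ∷ pxs) (rx ∷ rxs) =
  All.zipWith (λ (py , r) → R⇒S px py r) (pxs , rx) ∷ allPairs-within R⇒S pxs rxs

lastOf : {A : Set} → A → List A → A
lastOf x []       = x
lastOf _ (y ∷ ys) = lastOf y ys

lastOf-∈ : {A : Set} (x : A) (xs : List A) → lastOf x xs ∈ x ∷ xs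
lastOf-∈ x []       = here refl
lastOf-∈ _ (y ∷ ys) = there (lastOf-∈ y ys)

module _ {A : Set} (f w : A → ℕ) (K : ℕ) where

  Separated : A → A → Set
  Separated x y = K ≤ ∣ f x - f y ∣ + (w x + w y)

  Gap : A → A → Set
  Gap x y = f x + K ≤ f y + (w x + w y)

  separated-sym : ∀ {x y} → Separated x y → Separated y x
  separated-sym {x} {y} = subst₂ (λ d v → K ≤ d + v) (∣-∣-comm (f x) (f y)) (+-comm (w x) (w y))

  separated⇒gap : ∀ {x y} → f x ≤ f y → Separated x y → Gap x y
  separated⇒gap {x} {y} fx≤fy sep = begin
    f x + K                             ≤⟨ +-monoʳ-≤ (f x) sep ⟩
    f x + (∣ f x - f y ∣ + (w x + w y)) ≡⟨ cong (λ d → f x + (d + (w x + w y))) (m≤n⇒∣m-n∣≡n∸m fx≤fy) ⟩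
    f x + ((f y ∸ f x) + (w x + w y))   ≡⟨ sym (+-assoc (f x) _ _) ⟩
    f x + (f y ∸ f x) + (w x + w y)     ≡⟨ cong (_+ (w x + w y)) (m+[n∸m]≡n fx≤fy) ⟩
    f y + (w x + w y)                   ∎
    where open ≤-Reasoning

  telescope : ∀ x xs → Linked Gap (x ∷ xs) →
    f x + length xs * K + (w x + w (lastOf x xs)) ≤ f (lastOf x xs) + 2 * sum (map w (x ∷ xs))
  telescope x [] [-] = ≤-reflexive (single (f x) (w x))
    where
    single : ∀ a b → a + 0 + (b + b) ≡ a + 2 * (b + 0)
    single = solve-∀
  telescope x (y ∷ ys) (gap ∷ gaps) = begin
    f x + suc (length ys) * K + (w x + w z)              ≡⟨ regroup₁ (f x) K (length ys) (w x) (w z) ⟩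
    (f x + K) + (length ys * K + (w x + w z))            ≤⟨ +-monoˡ-≤ _ gap ⟩
    (f y + (w x + w y)) + (length ys * K + (w x + w z))  ≡⟨ regroup₂ (f y) (w x) (w y) (length ys * K) (w z) ⟩
    (f y + length ys * K + (w y + w z)) + 2 * w x        ≤⟨ +-monoˡ-≤ _ (telescope y ys gaps) ⟩
    (f z + 2 * S) + 2 * w x                              ≡⟨ regroup₃ (f z) S (w x) ⟩
    f z + 2 * (w x + S)                                  ∎
    where
    open ≤-Reasoning
    z : A
    z = lastOf y ys
    S : ℕ
    S = sum (map w (y ∷ ys))
    regroup₁ : ∀ a k l b c → a + suc l * k + (b + c) ≡ (a + k) + (l * k + (b + c))
    regroup₁ = solve-∀
    regroup₂ : ∀ a b c d e → (a + (b + c)) + (d + (b + e)) ≡ (a + d + (c + e)) + 2 * b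
    regroup₂ = solve-∀
    regroup₃ : ∀ a s b → (a + 2 * s) + 2 * b ≡ a + 2 * (b + s)
    regroup₃ = solve-∀

  open Sort (On.decTotalOrder ≤-decTotalOrder f) using (sort; sort-↭; sort-↗)

  spread : ∀ x xs → AllPairs Separated (x ∷ xs) →
    ∃₂ λ bot top → bot ∈ x ∷ xs × top ∈ x ∷ xs ×
      f bot + length xs * K + (w bot + w top) ≤ f top + 2 * sum (map w (x ∷ xs))
  spread x xs seps with sort (x ∷ xs) | sort-↭ (x ∷ xs) | sort-↗ (x ∷ xs)
  ... | []     | σ | _      = ⊥-elim (0≢1+n (↭.↭-length σ))
  ... | y ∷ ys | σ | sorted =
    y , lastOf y ys , ↭.∈-resp-↭ σ (here refl) , ↭.∈-resp-↭ σ (lastOf-∈ y ys) ,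
    subst₂ (λ l s → f y + l * K + (w y + w (lastOf y ys)) ≤ f (lastOf y ys) + 2 * s)
      (suc-injective (↭.↭-length σ)) (sum-↭ (↭.map⁺ w σ)) (telescope y ys gaps)
    where
    sortedSeps : AllPairs Separated (y ∷ ys)
    sortedSeps = Setoid↭.AllPairs-resp-↭ (setoid A) separated-sym
      ((λ { refl s → s }) , (λ { refl s → s })) (↭⇒↭ₛ (↭-sym σ)) seps
    gaps : Linked Gap (y ∷ ys)
    gaps = Linked.zipWith (λ (fx≤fy , sep) → separated⇒gap fx≤fy sep)
      (sorted , AllPairs⇒Linked sortedSeps)

starDist : {m : ℕ} → Fin m → Fin m → ℕ
starDist fzero    fzero    = 0
starDist fzero    (fsuc _) = 1
starDist (fsuc _) fzero    = 1
starDist (fsuc k) (fsuc l) with k ≟ᶠ l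
... | yes _ = 0
... | no  _ = 2

module _ {m : ℕ} where

  starDist-refl : (k : Fin m) → starDist k k ≡ 0
  starDist-refl fzero = refl
  starDist-refl (fsuc k) with k ≟ᶠ k
  ... | yes _   = refl
  ... | no  k≢k = ⊥-elim (k≢k refl)

  starDist≤2 : (k l : Fin m) → starDist k l ≤ 2
  starDist≤2 fzero    fzero    = z≤n
  starDist≤2 fzero    (fsuc _) = s≤s z≤n
  starDist≤2 (fsuc _) fzero    = s≤s z≤n
  starDist≤2 (fsuc k) (fsuc l) with k ≟ᶠ l
  ... | yes _ = z≤n
  ... | no  _ = ≤-refl

  starDist-adj : {k k′ : Fin m} (l : Fin m) → StarAdj k k′ → starDist k l ≤ suc (starDist k′ l)
  starDist-adj {fzero}  {fzero}  _        (inj₁ (_ , k′≢0)) = ⊥-elim (k′≢0 refl)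
  starDist-adj {fzero}  {fzero}  _        (inj₂ (_ , k≢0))  = ⊥-elim (k≢0 refl)
  starDist-adj {fzero}  {fsuc _} fzero    _ = z≤n
  starDist-adj {fzero}  {fsuc _} (fsuc _) _ = s≤s z≤n
  starDist-adj {fsuc _} {fzero}  fzero    _ = ≤-refl
  starDist-adj {fsuc k} {fzero}  (fsuc l) _ = starDist≤2 (fsuc k) (fsuc l)
  starDist-adj {fsuc _} {fsuc _} _        (inj₁ (() , _))
  starDist-adj {fsuc _} {fsuc _} _        (inj₂ (() , _))

  starDist≤leaves : (k l : Fin m) → starDist k l ≤ [ toℕ k ≢ 0 ] + [ toℕ l ≢ 0 ]
  starDist≤leaves fzero    fzero    = z≤n
  starDist≤leaves fzero    (fsuc _) = ≤-refl
  starDist≤leaves (fsuc _) fzero    = ≤-refl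
  starDist≤leaves (fsuc k) (fsuc l) = starDist≤2 (fsuc k) (fsuc l)

module _ {m n : ℕ} where

  dist : Vertex m n → Vertex m n → ℕ
  dist (k , p) (l , q) = ∣ toℕ p - toℕ q ∣ + starDist k l

  pathAdj⇒∣-∣≡1 : {p q : Fin n} → PathAdj p q → ∣ toℕ p - toℕ q ∣ ≡ 1
  pathAdj⇒∣-∣≡1 {p} {q} (inj₁ p≡1+q) rewrite p≡1+q = trans (∣-∣-comm (suc (toℕ q)) (toℕ q)) (∣n-1+n∣≡1 (toℕ q))
  pathAdj⇒∣-∣≡1 {p} {q} (inj₂ q≡1+p) rewrite q≡1+p = ∣n-1+n∣≡1 (toℕ p)

  dist-adj : {x y : Vertex m n} (z : Vertex m n) → Adj x y → dist x z ≤ suc (dist y z)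
  dist-adj {k , p} {_ , q} (l , r) (inj₁ (refl , adj)) = +-monoˡ-≤ (starDist k l) (begin
    ∣ toℕ p - toℕ r ∣                      ≤⟨ ∣-∣-triangle (toℕ p) (toℕ q) (toℕ r) ⟩
    ∣ toℕ p - toℕ q ∣ + ∣ toℕ q - toℕ r ∣  ≡⟨ cong (_+ ∣ toℕ q - toℕ r ∣) (pathAdj⇒∣-∣≡1 adj) ⟩
    suc ∣ toℕ q - toℕ r ∣                  ∎)
    where open ≤-Reasoning
  dist-adj {k , p} {k′ , _} (l , r) (inj₂ (refl , adj)) =
    ≤-trans (+-monoʳ-≤ ∣ toℕ p - toℕ r ∣ (starDist-adj l adj)) (≤-reflexive (+-suc _ _))

  dist-≤-walk : {x y : Vertex m n} {ℓ : ℕ} → Walk x y ℓ → dist x y ≤ ℓ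
  dist-≤-walk {k , p} here rewrite ∣n-n∣≡0 (toℕ p) | starDist-refl k = z≤n
  dist-≤-walk {y = y} (step adj w) = ≤-trans (dist-adj y adj) (s≤s (dist-≤-walk w))

  adj-sym : {x y : Vertex m n} → Adj x y → Adj y x
  adj-sym (inj₁ (refl , inj₁ e)) = inj₁ (refl , inj₂ e)
  adj-sym (inj₁ (refl , inj₂ e)) = inj₁ (refl , inj₁ e)
  adj-sym (inj₂ (refl , inj₁ e)) = inj₂ (refl , inj₂ e)
  adj-sym (inj₂ (refl , inj₂ e)) = inj₂ (refl , inj₁ e)

  _++ʷ_ : {x y z : Vertex m n} {a b : ℕ} → Walk x y a → Walk y z b → Walk x z (a + b)
  here     ++ʷ w = w
  step e v ++ʷ w = step e (v ++ʷ w)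

  reverseʷ : {x y : Vertex m n} {a : ℕ} → Walk x y a → Walk y x a
  reverseʷ here = here
  reverseʷ {a = suc a} (step e w) = subst (Walk _ _) (+-comm a 1) (reverseʷ w ++ʷ step (adj-sym e) here)

  ascend : (k : Fin m) (d : ℕ) (p q : Fin n) → toℕ q ≡ d + toℕ p → Walk (k , p) (k , q) d
  ascend k zero    p q q≡p = subst (λ q → Walk (k , p) (k , q) 0) (toℕ-injective (sym q≡p)) here
  ascend k (suc d) p q q≡d+1+p =
    step (inj₁ (refl , inj₂ (toℕ-fromℕ< 1+p<n))) (ascend k d (fromℕ< 1+p<n) q q≡d+p′)
    where
    1+p<n : suc (toℕ p) < n
    1+p<n = ≤-<-trans (s≤s (m≤n+m (toℕ p) d)) (subst (_< n) q≡d+1+p (toℕ<n q))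
    q≡d+p′ : toℕ q ≡ d + toℕ (fromℕ< 1+p<n)
    q≡d+p′ = trans q≡d+1+p (trans (sym (+-suc d (toℕ p))) (cong (d +_) (sym (toℕ-fromℕ< 1+p<n))))

  pathWalk : (k : Fin m) (p q : Fin n) → Walk (k , p) (k , q) ∣ toℕ p - toℕ q ∣
  pathWalk k p q with ≤-total (toℕ p) (toℕ q)
  ... | inj₁ p≤q = subst (Walk _ _) (sym (m≤n⇒∣m-n∣≡n∸m p≤q))
                     (ascend k (toℕ q ∸ toℕ p) p q (sym (m∸n+n≡m p≤q)))
  ... | inj₂ q≤p = subst (Walk _ _) (sym (m≤n⇒∣n-m∣≡n∸m q≤p))
                     (reverseʷ (ascend k (toℕ p ∸ toℕ q) q p (sym (m∸n+n≡m q≤p))))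

  starWalk : (k l : Fin m) (p : Fin n) → Walk (k , p) (l , p) (starDist k l)
  starWalk fzero    fzero    p = here
  starWalk fzero    (fsuc l) p = step (inj₂ (refl , inj₁ (refl , λ ()))) here
  starWalk (fsuc k) fzero    p = step (inj₂ (refl , inj₂ (refl , λ ()))) here
  starWalk (fsuc k) (fsuc l) p with k ≟ᶠ l
  ... | yes refl = here
  ... | no  _    = step (inj₂ (refl , inj₂ (refl , λ ()))) (step (inj₂ (refl , inj₁ (refl , λ ()))) here)

  isDist-dist : (x y : Vertex m n) → IsDist x y (dist x y)
  isDist-dist (k , p) (l , q) = pathWalk k p q ++ʷ starWalk k l q , λ _ → dist-≤-walk

  weight : ℕ → Vertex m n → ℕ
  weight b (k , p) = [ toℕ k ≢ 0 ] + [ toℕ p ≢ b ]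

  weight≡0⇒≡ : ∀ b {x y : Vertex m n} → weight b x ≡ 0 → weight b y ≡ 0 → x ≡ y
  weight≡0⇒≡ b {k , p} {l , q} wx≡0 wy≡0 = cong₂ _,_
    (toℕ-injective (trans ([≢]≡0⇒≡ (m+n≡0⇒m≡0 _ wx≡0)) (sym ([≢]≡0⇒≡ (m+n≡0⇒m≡0 _ wy≡0)))))
    (toℕ-injective (trans ([≢]≡0⇒≡ (m+n≡0⇒n≡0 _ wx≡0)) (sym ([≢]≡0⇒≡ (m+n≡0⇒n≡0 _ wy≡0)))))

-- a is the 0-based index of V_(i) and b = a + h that of V_(j); w₁ lies in column b + 1.
module GPlus (m′ h′ a : ℕ) (a+1≤h′ : a + 1 ≤ h′) where

  h n b : ℕ
  h = suc h′
  n = h + h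
  b = a + h

  InColumns : ℕ → Set
  InColumns p = p ≡ a ⊎ p ≡ b ⊎ p ≡ suc b

  ∣a-b∣≡h : ∣ a - b ∣ ≡ h
  ∣a-b∣≡h = ∣m-m+n∣≡n a h

  ∣a-1+b∣≡1+h : ∣ a - suc b ∣ ≡ suc h
  ∣a-1+b∣≡1+h = trans (cong (∣ a -_∣) (sym (+-suc a h))) (∣m-m+n∣≡n a (suc h))

  ∣1+b-b∣≡1 : ∣ suc b - b ∣ ≡ 1
  ∣1+b-b∣≡1 = trans (∣-∣-comm (suc b) b) (∣n-1+n∣≡1 b)

  columnDist : ∀ {p q} → InColumns p → InColumns q → ∣ p - q ∣ ≤ h′ + ([ p ≢ b ] + [ q ≢ b ])
  columnDist (inj₁ refl)        (inj₁ refl)        rewrite ∣n-n∣≡0 a = z≤n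
  columnDist (inj₁ refl)        (inj₂ (inj₁ refl)) rewrite ∣a-b∣≡h | ∣n-n∣≡0 b = ≤-reflexive (+-comm 1 h′)
  columnDist (inj₁ refl)        (inj₂ (inj₂ refl)) rewrite ∣a-1+b∣≡1+h | ∣a-b∣≡h | ∣1+b-b∣≡1 = ≤-reflexive (+-comm 2 h′)
  columnDist (inj₂ (inj₁ refl)) (inj₁ refl)        rewrite ∣-∣-comm b a | ∣a-b∣≡h | ∣n-n∣≡0 b = ≤-reflexive (+-comm 1 h′)
  columnDist (inj₂ (inj₁ refl)) (inj₂ (inj₁ refl)) rewrite ∣n-n∣≡0 b = z≤n
  columnDist (inj₂ (inj₁ refl)) (inj₂ (inj₂ refl)) rewrite ∣-∣-comm b (suc b) | ∣1+b-b∣≡1 | ∣n-n∣≡0 b = m≤n+m 1 h′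
  columnDist (inj₂ (inj₂ refl)) (inj₁ refl)        rewrite ∣-∣-comm (suc b) a | ∣a-1+b∣≡1+h | ∣a-b∣≡h | ∣1+b-b∣≡1 = ≤-reflexive (+-comm 2 h′)
  columnDist (inj₂ (inj₂ refl)) (inj₂ (inj₁ refl)) rewrite ∣1+b-b∣≡1 | ∣n-n∣≡0 b = m≤n+m 1 h′
  columnDist (inj₂ (inj₂ refl)) (inj₂ (inj₂ refl)) rewrite ∣n-n∣≡0 (suc b) = z≤n

  V : Set
  V = Vertex (suc m′) n

  InG⁺ : V → Set
  InG⁺ = InGPlus (suc a) (suc a + h)

  inColumns : {x : V} → InG⁺ x → InColumns (toℕ (proj₂ x))
  inColumns (inj₁ e)              = inj₁ (suc-injective e)
  inColumns (inj₂ (inj₁ e))       = inj₂ (inj₁ (suc-injective e))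
  inColumns (inj₂ (inj₂ (_ , e))) = inj₂ (inj₂ (suc-injective e))

  dist≤weights : {x y : V} → InG⁺ x → InG⁺ y → dist x y ≤ h′ + (weight b x + weight b y)
  dist≤weights {k , p} {l , q} x∈ y∈ = begin
    ∣ toℕ p - toℕ q ∣ + starDist k l  ≤⟨ +-mono-≤ (columnDist (inColumns x∈) (inColumns y∈)) (starDist≤leaves k l) ⟩
    h′ + (cp + cq) + (lk + ll)        ≡⟨ regroup h′ cp cq lk ll ⟩
    h′ + ((lk + cp) + (ll + cq))      ∎
    where
    open ≤-Reasoning
    cp cq lk ll : ℕ
    cp = [ toℕ p ≢ b ]
    cq = [ toℕ q ≢ b ]
    lk = [ toℕ k ≢ 0 ]
    ll = [ toℕ l ≢ 0 ]
    regroup : ∀ d x y u v → d + (x + y) + (u + v) ≡ d + ((u + x) + (v + y))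
    regroup = solve-∀

  separated-G⁺ : (f : V → ℕ) → IsRadioLabeling (suc m′) n f →
    {x y : V} → InG⁺ x → InG⁺ y → x ≢ y → Separated f (weight b) (h′ + 4) x y
  separated-G⁺ f radio {x} {y} x∈ y∈ x≢y = +-cancelˡ-≤ h′ _ _ (begin
    h′ + (h′ + 4)             ≡⟨ diam+2 h′ ⟩
    n + 1 + 1                 ≤⟨ radio x y x≢y (dist x y) (isDist-dist x y) ⟩
    ∣ f x - f y ∣ + dist x y  ≤⟨ +-monoʳ-≤ ∣ f x - f y ∣ (dist≤weights x∈ y∈) ⟩
    ∣ f x - f y ∣ + (h′ + W)  ≡⟨ x∙yz≈y∙xz ∣ f x - f y ∣ h′ W ⟩
    h′ + (∣ f x - f y ∣ + W)  ∎)
    where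
    open ≤-Reasoning
    W : ℕ
    W = weight b x + weight b y
    diam+2 : ∀ h′ → h′ + (h′ + 4) ≡ suc h′ + suc h′ + 1 + 1
    diam+2 = solve-∀

  1+b<n : suc b < n
  1+b<n = s≤s (+-monoˡ-≤ h (subst (_≤ h′) (+-comm a 1) a+1≤h′))

  b<n : b < n
  b<n = <-trans (n<1+n b) 1+b<n

  a<n : a < n
  a<n = ≤-<-trans (m≤m+n a h) b<n

  pA pB pW : Fin n
  pA = fromℕ< a<n
  pB = fromℕ< b<n
  pW = fromℕ< 1+b<n

  onColumn : Fin n → Fin (suc m′) → V
  onColumn p k = k , p

  column : Fin n → List V
  column p = tabulate (onColumn p)

  All-column : {P : V → Set} (p : Fin n) → (∀ k → P (k , p)) → All P (column p)
  All-column p = All.tabulate⁺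

  w₁ : V
  w₁ = fzero , pW

  columns : List V
  columns = column pA ++ column pB

  G⁺ : List V
  G⁺ = w₁ ∷ columns

  G⁺⊆InG⁺ : All InG⁺ G⁺
  G⁺⊆InG⁺ = inj₂ (inj₂ (refl , cong suc (toℕ-fromℕ< 1+b<n))) ∷
    All.++⁺ (All-column pA λ _ → inj₁ (cong suc (toℕ-fromℕ< a<n)))
            (All-column pB λ _ → inj₂ (inj₁ (cong suc (toℕ-fromℕ< b<n))))

  column-unique : (p : Fin n) → AllPairs _≢_ (column p)
  column-unique p = AllPairs.tabulate⁺ {f = onColumn p} (λ k≢l eq → k≢l (cong proj₁ eq))

  ≢-column : {x y : V} → proj₂ x ≢ proj₂ y → x ≢ y
  ≢-column p≢q refl = p≢q refl

  pA<pB : toℕ pA < toℕ pB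
  pA<pB = subst₂ _<_ (sym (toℕ-fromℕ< a<n)) (sym (toℕ-fromℕ< b<n)) (m<m+n a z<s)

  pB<pW : toℕ pB < toℕ pW
  pB<pW = subst₂ _<_ (sym (toℕ-fromℕ< b<n)) (sym (toℕ-fromℕ< 1+b<n)) (n<1+n b)

  G⁺-unique : AllPairs _≢_ G⁺
  G⁺-unique =
    All.++⁺ (All-column pA λ _ → ≢-column (≢-sym (<⇒≢ᶠ (<-trans pA<pB pB<pW))))
            (All-column pB λ _ → ≢-column (≢-sym (<⇒≢ᶠ pB<pW))) ∷
    AllPairs.++⁺ (column-unique pA) (column-unique pB)
      (All-column pA λ _ → All-column pB λ _ → ≢-column (<⇒≢ᶠ pA<pB))

  length-columns : length columns ≡ suc m′ + suc m′
  length-columns = trans (length-++ (column pA))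
    (cong₂ _+_ (length-tabulate (onColumn pA)) (length-tabulate (onColumn pB)))

  [pA≢b]≡1 : [ toℕ pA ≢ b ] ≡ 1
  [pA≢b]≡1 = trans (cong [_≢ b ] (toℕ-fromℕ< a<n)) (cong (1 ⊓_) ∣a-b∣≡h)

  [pB≢b]≡0 : [ toℕ pB ≢ b ] ≡ 0
  [pB≢b]≡0 = trans (cong [_≢ b ] (toℕ-fromℕ< b<n)) (cong (1 ⊓_) (∣n-n∣≡0 b))

  [pW≢b]≡1 : [ toℕ pW ≢ b ] ≡ 1
  [pW≢b]≡1 = trans (cong [_≢ b ] (toℕ-fromℕ< 1+b<n)) (cong (1 ⊓_) ∣1+b-b∣≡1)

  sum-weight-column : (p : Fin n) {c : ℕ} → [ toℕ p ≢ b ] ≡ c →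
    sum (map (weight b) (column p)) ≡ c + m′ * suc c
  sum-weight-column p refl = trans (cong sum (map-tabulate (onColumn p) (weight b)))
    (cong ([ toℕ p ≢ b ] +_) (sum-tabulate-const m′ _))

  gapSum weightSum : ℕ
  gapSum    = (suc m′ + suc m′) * (h′ + 4)
  weightSum = 2 + 3 * m′

  sum-weights : sum (map (weight b) G⁺) ≡ weightSum
  sum-weights = begin
    [ toℕ pW ≢ b ] + sum (map (weight b) (column pA ++ column pB))
      ≡⟨ cong ([ toℕ pW ≢ b ] +_) (trans (cong sum (map-++ (weight b) (column pA) (column pB)))
                                         (sum-++ (map (weight b) (column pA)) _)) ⟩
    [ toℕ pW ≢ b ] + (sum (map (weight b) (column pA)) + sum (map (weight b) (column pB)))
      ≡⟨ cong₂ _+_ [pW≢b]≡1 (cong₂ _+_ (sum-weight-column pA [pA≢b]≡1) (sum-weight-column pB [pB≢b]≡0)) ⟩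
    1 + ((1 + m′ * 2) + (0 + m′ * 1))
      ≡⟨ count m′ ⟩
    weightSum ∎
    where
    open ≡-Reasoning
    count : ∀ m′ → 1 + ((1 + m′ * 2) + (0 + m′ * 1)) ≡ 2 + 3 * m′
    count = solve-∀

  gapSum+1≡ : gapSum + 1 ≡ (suc m′ * n + 3) + 2 * weightSum
  gapSum+1≡ = identity m′ h′
    where
    identity : ∀ m′ h′ → (suc m′ + suc m′) * (h′ + 4) + 1 ≡ (suc m′ * (suc h′ + suc h′) + 3) + 2 * (2 + 3 * m′)
    identity = solve-∀

  2*weightSum<gapSum : 2 * weightSum < gapSum
  2*weightSum<gapSum = +-cancelʳ-≤ 1 _ _ (begin
    suc (2 * weightSum) + 1           ≡⟨ +-comm (suc (2 * weightSum)) 1 ⟩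
    2 + 2 * weightSum                 ≤⟨ +-monoˡ-≤ (2 * weightSum) (≤-trans (n≤1+n 2) (m≤n+m 3 (suc m′ * n))) ⟩
    (suc m′ * n + 3) + 2 * weightSum  ≡⟨ sym gapSum+1≡ ⟩
    gapSum + 1                        ∎)
    where open ≤-Reasoning

  spread-G⁺ : (f : V → ℕ) → IsRadioLabeling (suc m′) n f →
    ∃₂ λ bot top → InG⁺ bot × InG⁺ top ×
      f bot + gapSum + (weight b bot + weight b top) ≤ f top + 2 * weightSum
  spread-G⁺ f radio
    with spread f (weight b) (h′ + 4) w₁ columns (allPairs-within (separated-G⁺ f radio) G⁺⊆InG⁺ G⁺-unique)
  ... | bot , top , bot∈ , top∈ , ineq =
    bot , top , All.lookup G⁺⊆InG⁺ bot∈ , All.lookup G⁺⊆InG⁺ top∈ ,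
    subst₂ (λ l s → f bot + l * (h′ + 4) + (weight b bot + weight b top) ≤ f top + 2 * s)
      length-columns sum-weights ineq

  endpoint-weights-positive : (f : V → ℕ) {x y : V} →
    f x + gapSum + (weight b x + weight b y) ≤ f y + 2 * weightSum →
    1 ≤ weight b x + weight b y
  endpoint-weights-positive f {x} {y} ineq with weight b x in wx | weight b y in wy
  ... | suc _ | _     = s≤s z≤n
  ... | zero  | suc _ = s≤s z≤n
  ... | zero  | zero  with weight≡0⇒≡ b {x} {y} wx wy
  ... | refl = ⊥-elim (<⇒≱ 2*weightSum<gapSum
                 (+-cancelˡ-≤ (f x) _ _ (subst (_≤ f x + 2 * weightSum) (+-identityʳ _) ineq)))

lemma3p3 : (m h i : ℕ) → 3 ≤ m → 1 ≤ h → 1 ≤ i → i + 1 ≤ h →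
    (f : Vertex m (h + h) → ℕ) → IsRadioLabeling m (h + h) f →
    ∃ λ (x : Vertex m (h + h)) → ∃ λ (y : Vertex m (h + h)) →
    InGPlus i (i + h) x × InGPlus i (i + h) y ×
    f y + (m * (h + h) + 3) ≤ f x
lemma3p3 zero     _        _       ()
lemma3p3 (suc _)  _        zero    _ _ ()
lemma3p3 (suc _)  zero     (suc _) _ _ _ ()
lemma3p3 (suc m′) (suc h′) (suc a) _ _ _ (s≤s a+1≤h′) f radio =
  let open GPlus m′ h′ a a+1≤h′
      (bot , top , bot∈ , top∈ , ineq) = spread-G⁺ f radio
  in top , bot , top∈ , bot∈ , +-cancel-excess {s = f bot} {t = f top} gapSum+1≡ (endpoint-weights-positive f ineq) ineq
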